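{- Let $n\ge5$ and $s$ be integers with $1<s<n/2$. Then $$\pi(C_n(1,s))\ge\frac{(n-1)(\sqrt{2n}-7)^3}{12n}.$$
   Context: The circulant graph $C_n(1,s)$ has vertex set $\mathbb{Z}_n$, with $i,j$ adjacent iff $i-j\in\{\pm1,\pm s\}$ mod $n$. An all-to-all routing $R$ of a graph $G$ is a set of oriented paths with exactly one path from $x$ to $y$ for each ordered pair of distinct vertices. The load of an edge is the number of paths of $R$ using it in either direction; $\pi(G,R)$ is the maximum edge load and $\pi(G)=\min_R\pi(G,R)$ is the edge-forwarding index. -}

module Defs where

open import Data.Nat using (ℕ; zero; suc; _+_; _*_; _∸_; _⊔_)
open import Data.Nat.Properties using () renaming (_≟_ to _≟ℕ_)
open import Data.Fin using (Fin; toℕ) renaming (_≟_ to _≟F_)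
open import Data.Fin.Properties using ()
open import Data.List using (List; []; _∷_; map; foldr; zip; drop; head; last; allFin)
open import Data.Nat.ListAction using (sum)
open import Data.Bool.ListAction using (any)
open import Data.List.Relation.Unary.Linked using (Linked)
open import Data.List.Relation.Unary.Unique.Propositional using (Unique)
open import Data.Maybe using (just)
open import Data.Product using (_×_; _,_)
open import Data.Sum using (_⊎_)
open import Data.Bool using (Bool; if_then_else_; _∧_; _∨_)
open import Relation.Binary.PropositionalEquality using (_≡_; _≢_)
open import Relation.Nullary using (Dec)
open import Relation.Nullary.Decidable using (⌊_⌋; _⊎-dec_)

-- Vertices of C_n(1,s) are Fin n (i.e. Z_n).
-- StepBy n d i j  :  i + d ≡ j (mod n), written without % : since i, j < n
-- and 0 ≤ d < n, this holds iff i + d = j or i + d = j + n.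
StepBy : (n d : ℕ) → Fin n → Fin n → Set
StepBy n d i j = (toℕ i + d ≡ toℕ j) ⊎ (toℕ i + d ≡ toℕ j + n)

stepBy? : (n d : ℕ) → (i j : Fin n) → Dec (StepBy n d i j)
stepBy? n d i j = (toℕ i + d ≟ℕ toℕ j) ⊎-dec (toℕ i + d ≟ℕ toℕ j + n)

Adj : (n s : ℕ) → Fin n → Fin n → Set
Adj n s i j = StepBy n 1 i j ⊎ StepBy n (n ∸ 1) i j ⊎ StepBy n s i j ⊎ StepBy n (n ∸ s) i j

adj? : (n s : ℕ) → (i j : Fin n) → Dec (Adj n s i j)
adj? n s i j = stepBy? n 1 i j ⊎-dec (stepBy? n (n ∸ 1) i j ⊎-dec (stepBy? n s i j ⊎-dec stepBy? n (n ∸ s) i j))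

IsPath : (n s : ℕ) → Fin n → Fin n → List (Fin n) → Set
IsPath n s x y l = Linked (Adj n s) l × Unique l × head l ≡ just x × last l ≡ just y

-- An all-to-all routing: exactly one path (route x y) for each ordered pair x ≠ y.
-- (route x x is irrelevant and never counted.)
record AllToAllRouting (n s : ℕ) : Set where
  field
    route  : Fin n → Fin n → List (Fin n)
    isPath : ∀ x y → x ≢ y → IsPath n s x y (route x y)

open AllToAllRouting public

usesEdge : {n : ℕ} → Fin n → Fin n → List (Fin n) → Bool
usesEdge u v l = any (λ { (a , b) → (⌊ a ≟F u ⌋ ∧ ⌊ b ≟F v ⌋) ∨ (⌊ a ≟F v ⌋ ∧ ⌊ b ≟F u ⌋) })
                     (zip l (drop 1 l))

load : {n s : ℕ} → AllToAllRouting n s → Fin n → Fin n → ℕ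
load {n} R u v =
  sum (map (λ x → sum (map (λ y → if ⌊ x ≟F y ⌋ then 0
                                   else (if usesEdge u v (route R x y) then 1 else 0))
                           (allFin n)))
           (allFin n))

maxLoad : {n s : ℕ} → AllToAllRouting n s → ℕ
maxLoad {n} {s} R =
  foldr _⊔_ 0 (map (λ u → foldr _⊔_ 0 (map (λ v → if ⌊ adj? n s u v ⌋ then load R u v else 0)
                                           (allFin n)))
                   (allFin n))

module Submission where

-- Every vertex of C_n(1,s) has at most four neighbours, so the loads of the
-- ordered adjacent pairs sum to at most 4nπ, while a route of length ℓ contributes 2ℓ to that
-- sum: the route lengths d(x,y) sum to at most 2nπ. On the other hand, the endpoint of a walk
-- from x is determined by its length L and two step counts P, Q ≤ L, and padding walks with
-- round trips to length r − 1 or r shows that at most 2(r+1)² vertices lie within distance r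
-- of x. Hence Σ_y d(x,y) ≥ Σ_{r<K} (n − 2(r+1)²) = Kn − K(K+1)(2K+1)/3 whenever 2K² ≤ n, and
-- K = ⌊√(n/2)⌋ gives the bound (for n < 50, K = 1 and a finite check suffice).

open import Defs
open import Data.Nat using (ℕ; zero; suc; _+_; _*_; _∸_; _^_; _≤_; _<_; _⊔_; _⊓_; _/_; _%_; z≤n; s≤s; NonZero; >-nonZero⁻¹)
open import Data.Nat.Properties
open import Data.Nat.DivMod using (m≡m%n+[m/n]*n; m%n<n; m<n⇒m%n≡m; %-distribˡ-+; [m+n]%n≡m%n; [m+kn]%n≡m%n)
open import Data.Nat.ListAction using (sum)
open import Data.Nat.ListAction.Properties using (sum-++)
open import Data.Nat.Tactic.RingSolver using (solve-∀)
open import Data.Bool using (Bool; true; false; T; if_then_else_; _∧_; _∨_)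
open import Data.Bool.Properties using (T-∧)
open import Data.Fin using (Fin; toℕ) renaming (_≟_ to _≟F_)
open import Data.Fin.Properties using (toℕ-injective; toℕ<n)
open import Data.List using (List; []; _∷_; [_]; _++_; map; length; foldr; upTo; allFin; cartesianProduct; last)
open import Data.List.Properties using (map-++; length-++; length-map; length-upTo; length-tabulate; upTo-∷ʳ)
open import Data.List.Membership.Propositional using (_∈_)
open import Data.List.Membership.Propositional.Properties using (∈-allFin; ∈-upTo⁺; ∈-cartesianProduct⁺)
open import Data.List.Relation.Unary.Any using (here; there)
open import Data.List.Relation.Unary.All as All using (All; []; _∷_; all?)
open import Data.List.Relation.Unary.AllPairs using ([]; _∷_)
open import Data.List.Relation.Unary.Linked using (Linked; []; [-]; _∷_)
open import Data.List.Relation.Unary.Unique.Propositional using (Unique)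
open import Data.List.Relation.Unary.Unique.Propositional.Properties using (allFin⁺)
open import Data.Maybe using (just)
open import Data.Product using (∃-syntax; ∃₂; _×_; _,_; proj₁)
open import Data.Product.Properties using (≡-dec)
open import Data.Sum using (_⊎_; inj₁; inj₂; [_,_]′)
open import Data.Unit using (tt)
open import Function using (_∘_)
open import Function.Bundles using (Equivalence)
open import Relation.Nullary using (¬_; yes; no; contradiction)
open import Relation.Nullary.Decidable using (⌊_⌋; toWitness; fromWitness)
open import Relation.Binary.Core using (Rel)
open import Relation.Binary.Definitions using (DecidableEquality; Decidable; Symmetric)
open import Relation.Binary.PropositionalEquality
  using (_≡_; _≢_; refl; sym; trans; cong; cong₂; subst; module ≡-Reasoning)

𝟙 : Bool → ℕ
𝟙 b = if b then 1 else 0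

𝟙-true : ∀ {b} → T b → 𝟙 b ≡ 1
𝟙-true {true} _ = refl

𝟙-false : ∀ {b} → ¬ T b → 𝟙 b ≡ 0
𝟙-false {false} _ = refl
𝟙-false {true}  ¬t = contradiction tt ¬t

𝟙-∧ : ∀ b c → 𝟙 (b ∧ c) ≡ 𝟙 b * 𝟙 c
𝟙-∧ true  c = sym (+-identityʳ (𝟙 c))
𝟙-∧ false c = refl

T-∧⁻ : ∀ {b c} → T (b ∧ c) → T b × T c
T-∧⁻ = Equivalence.to T-∧

∑ : ∀ {a} {A : Set a} → List A → (A → ℕ) → ℕ
∑ xs f = sum (map f xs)

syntax ∑ xs (λ x → e) = ∑[ x ∈ xs ] e

module _ {a} {A : Set a} where

  ∑-cong : ∀ (xs : List A) {f g : A → ℕ} → (∀ x → f x ≡ g x) → ∑ xs f ≡ ∑ xs g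
  ∑-cong []       f≗g = refl
  ∑-cong (x ∷ xs) f≗g = cong₂ _+_ (f≗g x) (∑-cong xs f≗g)

  ∑-mono-≤ : ∀ (xs : List A) {f g : A → ℕ} → (∀ x → f x ≤ g x) → ∑ xs f ≤ ∑ xs g
  ∑-mono-≤ []       f≤g = z≤n
  ∑-mono-≤ (x ∷ xs) f≤g = +-mono-≤ (f≤g x) (∑-mono-≤ xs f≤g)

  ∑-distrib-+ : ∀ (xs : List A) (f g : A → ℕ) → ∑[ x ∈ xs ] (f x + g x) ≡ ∑ xs f + ∑ xs g
  ∑-distrib-+ []       f g = refl
  ∑-distrib-+ (x ∷ xs) f g = trans (cong (f x + g x +_) (∑-distrib-+ xs f g))
                                   (+-+-swap (f x) (g x) (∑ xs f) (∑ xs g))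
    where
    +-+-swap : ∀ a b c d → a + b + (c + d) ≡ a + c + (b + d)
    +-+-swap = solve-∀

  *-distribˡ-∑ : ∀ c (xs : List A) (f : A → ℕ) → c * ∑ xs f ≡ ∑[ x ∈ xs ] (c * f x)
  *-distribˡ-∑ c []       f = *-zeroʳ c
  *-distribˡ-∑ c (x ∷ xs) f = trans (*-distribˡ-+ c (f x) (∑ xs f)) (cong (c * f x +_) (*-distribˡ-∑ c xs f))

  ∑-const : ∀ (xs : List A) c → ∑ xs (λ _ → c) ≡ length xs * c
  ∑-const []       c = refl
  ∑-const (x ∷ xs) c = cong (c +_) (∑-const xs c)

  ∑-zero : ∀ (xs : List A) → ∑ xs (λ _ → 0) ≡ 0
  ∑-zero xs = trans (∑-const xs 0) (*-zeroʳ (length xs))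

  ∑-bounded : ∀ (xs : List A) {f : A → ℕ} {c} → (∀ x → f x ≤ c) → ∑ xs f ≤ length xs * c
  ∑-bounded xs {c = c} f≤c = ≤-trans (∑-mono-≤ xs f≤c) (≤-reflexive (∑-const xs c))

  ∑-if : ∀ (xs : List A) b (f : A → ℕ) → ∑[ x ∈ xs ] (if b then f x else 0) ≡ (if b then ∑ xs f else 0)
  ∑-if xs true  f = refl
  ∑-if xs false f = ∑-zero xs

  ∈⇒≤∑ : ∀ (f : A → ℕ) {x xs} → x ∈ xs → f x ≤ ∑ xs f
  ∈⇒≤∑ f (here refl)          = m≤m+n _ _
  ∈⇒≤∑ f {xs = y ∷ _} (there x∈xs) = ≤-trans (∈⇒≤∑ f x∈xs) (m≤n+m _ (f y))

  ∑-𝟙≡0 : ∀ (p : A → Bool) {xs} → All (λ x → ¬ T (p x)) xs → ∑[ x ∈ xs ] 𝟙 (p x) ≡ 0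
  ∑-𝟙≡0 p []          = refl
  ∑-𝟙≡0 p (¬px ∷ ¬ps) = cong₂ _+_ (𝟙-false ¬px) (∑-𝟙≡0 p ¬ps)

  ∑-𝟙≤1 : ∀ (p : A → Bool) {xs} → Unique xs → (∀ x y → T (p x) → T (p y) → x ≡ y) →
          ∑[ x ∈ xs ] 𝟙 (p x) ≤ 1
  ∑-𝟙≤1 p []                  p-unique = z≤n
  ∑-𝟙≤1 p {x ∷ _} (x∉ ∷ uniq) p-unique with p x in px
  ... | false = ∑-𝟙≤1 p uniq p-unique
  ... | true  = ≤-reflexive (cong suc (∑-𝟙≡0 p (All.map (λ x≢y py → x≢y (p-unique _ _ px′ py)) x∉)))
    where
    px′ : T (p x)
    px′ = subst T (sym px) tt

∈⇒≤foldr-⊔ : ∀ {a} {A : Set a} (f : A → ℕ) {x xs} → x ∈ xs → f x ≤ foldr _⊔_ 0 (map f xs)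
∈⇒≤foldr-⊔ f (here refl)                  = m≤m⊔n _ _
∈⇒≤foldr-⊔ f {xs = y ∷ _} (there x∈xs) = ≤-trans (∈⇒≤foldr-⊔ f x∈xs) (m≤n⊔m (f y) _)

length-allFin : ∀ n → length (allFin n) ≡ n
length-allFin n = length-tabulate {n = n} (λ i → i)

∑-comm : ∀ {a b} {A : Set a} {B : Set b} (xs : List A) (ys : List B) (F : A → B → ℕ) →
         ∑[ x ∈ xs ] ∑[ y ∈ ys ] F x y ≡ ∑[ y ∈ ys ] ∑[ x ∈ xs ] F x y
∑-comm []       ys F = sym (∑-zero ys)
∑-comm (x ∷ xs) ys F = trans (cong (∑ ys (F x) +_) (∑-comm xs ys F))
                             (sym (∑-distrib-+ ys (F x) (λ y → ∑[ x ∈ xs ] F x y)))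

∑∑-comm-∑∑ : ∀ {a} {A : Set a} (xs ys us vs : List A) (F : A → A → A → A → ℕ) →
  ∑[ x ∈ xs ] ∑[ y ∈ ys ] ∑[ u ∈ us ] ∑[ v ∈ vs ] F x y u v ≡
  ∑[ u ∈ us ] ∑[ v ∈ vs ] ∑[ x ∈ xs ] ∑[ y ∈ ys ] F x y u v
∑∑-comm-∑∑ xs ys us vs F = begin
  ∑[ x ∈ xs ] ∑[ y ∈ ys ] ∑[ u ∈ us ] ∑[ v ∈ vs ] F x y u v
    ≡⟨ ∑-cong xs (λ x → ∑-comm ys us _) ⟩
  ∑[ x ∈ xs ] ∑[ u ∈ us ] ∑[ y ∈ ys ] ∑[ v ∈ vs ] F x y u v
    ≡⟨ ∑-comm xs us _ ⟩
  ∑[ u ∈ us ] ∑[ x ∈ xs ] ∑[ y ∈ ys ] ∑[ v ∈ vs ] F x y u v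
    ≡⟨ ∑-cong us (λ u → ∑-cong xs (λ x → ∑-comm ys vs _)) ⟩
  ∑[ u ∈ us ] ∑[ x ∈ xs ] ∑[ v ∈ vs ] ∑[ y ∈ ys ] F x y u v
    ≡⟨ ∑-cong us (λ u → ∑-comm xs vs _) ⟩
  ∑[ u ∈ us ] ∑[ v ∈ vs ] ∑[ x ∈ xs ] ∑[ y ∈ ys ] F x y u v ∎
  where open ≡-Reasoning

∑-upTo-suc : ∀ K (f : ℕ → ℕ) → ∑ (upTo (suc K)) f ≡ ∑ (upTo K) f + f K
∑-upTo-suc K f = begin
  sum (map f (upTo (suc K)))      ≡⟨ cong (sum ∘ map f) (upTo-∷ʳ K) ⟨
  sum (map f (upTo K ++ [ K ]))   ≡⟨ cong sum (map-++ f (upTo K) [ K ]) ⟩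
  sum (map f (upTo K) ++ [ f K ]) ≡⟨ sum-++ (map f (upTo K)) [ f K ] ⟩
  ∑ (upTo K) f + (f K + 0)        ≡⟨ cong (∑ (upTo K) f +_) (+-identityʳ (f K)) ⟩
  ∑ (upTo K) f + f K              ∎
  where open ≡-Reasoning

∑-upTo-𝟙< : ∀ K m → ∑[ r ∈ upTo K ] 𝟙 ⌊ r <? m ⌋ ≡ K ⊓ m
∑-upTo-𝟙< zero    m = refl
∑-upTo-𝟙< (suc K) m with K <? m | ∑-upTo-suc K (λ r → 𝟙 ⌊ r <? m ⌋)
... | yes K<m | eq = begin
  ∑[ r ∈ upTo (suc K) ] 𝟙 ⌊ r <? m ⌋ ≡⟨ eq ⟩
  ∑[ r ∈ upTo K ] 𝟙 ⌊ r <? m ⌋ + 1  ≡⟨ cong (_+ 1) (∑-upTo-𝟙< K m) ⟩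
  K ⊓ m + 1                          ≡⟨ cong (_+ 1) (m≤n⇒m⊓n≡m (<⇒≤ K<m)) ⟩
  K + 1                              ≡⟨ +-comm K 1 ⟩
  suc K                              ≡⟨ m≤n⇒m⊓n≡m K<m ⟨
  suc K ⊓ m                          ∎
  where open ≡-Reasoning
... | no K≮m | eq = begin
  ∑[ r ∈ upTo (suc K) ] 𝟙 ⌊ r <? m ⌋ ≡⟨ eq ⟩
  ∑[ r ∈ upTo K ] 𝟙 ⌊ r <? m ⌋ + 0  ≡⟨ +-identityʳ _ ⟩
  ∑[ r ∈ upTo K ] 𝟙 ⌊ r <? m ⌋      ≡⟨ ∑-upTo-𝟙< K m ⟩
  K ⊓ m                              ≡⟨ m≥n⇒m⊓n≡n (≮⇒≥ K≮m) ⟩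
  m                                  ≡⟨ m≥n⇒m⊓n≡n (m≤n⇒m≤1+n (≮⇒≥ K≮m)) ⟨
  suc K ⊓ m                          ∎
  where open ≡-Reasoning

length-cartesianProduct : ∀ {a b} {A : Set a} {B : Set b} (xs : List A) (ys : List B) →
                          length (cartesianProduct xs ys) ≡ length xs * length ys
length-cartesianProduct []       ys = refl
length-cartesianProduct (x ∷ xs) ys = begin
  length (map (x ,_) ys ++ cartesianProduct xs ys)         ≡⟨ length-++ (map (x ,_) ys) ⟩
  length (map (x ,_) ys) + length (cartesianProduct xs ys) ≡⟨ cong₂ _+_ (length-map (x ,_) ys) (length-cartesianProduct xs ys) ⟩
  length ys + length xs * length ys                        ∎
  where open ≡-Reasoning

∑𝟙≤length-by-injection : ∀ {a b} {A : Set a} {B : Set b} → DecidableEquality B →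
  ∀ {xs : List A} (cs : List B) (p : A → Bool) (code : A → B) → Unique xs →
  (∀ x → T (p x) → code x ∈ cs) →
  (∀ x y → T (p x) → T (p y) → code x ≡ code y → x ≡ y) →
  ∑[ x ∈ xs ] 𝟙 (p x) ≤ length cs
∑𝟙≤length-by-injection {A = A} {B = B} _≟_ {xs} cs p code uniq code∈cs code-inj = begin
  ∑[ x ∈ xs ] 𝟙 (p x)                         ≤⟨ ∑-mono-≤ xs 𝟙≤∑codes ⟩
  ∑[ x ∈ xs ] ∑[ c ∈ cs ] 𝟙 (hasCode c x)     ≡⟨ ∑-comm xs cs (λ x c → 𝟙 (hasCode c x)) ⟩
  ∑[ c ∈ cs ] ∑[ x ∈ xs ] 𝟙 (hasCode c x)     ≤⟨ ∑-bounded cs (λ c → ∑-𝟙≤1 (hasCode c) uniq (hasCode-unique c)) ⟩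
  length cs * 1                               ≡⟨ *-identityʳ (length cs) ⟩
  length cs                                   ∎
  where
  open ≤-Reasoning
  hasCode : B → A → Bool
  hasCode c x = p x ∧ ⌊ code x ≟ c ⌋
  𝟙≤∑codes : ∀ x → 𝟙 (p x) ≤ ∑[ c ∈ cs ] 𝟙 (hasCode c x)
  𝟙≤∑codes x with p x in px
  ... | false = z≤n
  ... | true  = ≤-trans (≤-reflexive (sym (𝟙-true (fromWitness refl))))
                        (∈⇒≤∑ (λ c → 𝟙 ⌊ code x ≟ c ⌋) (code∈cs x (subst T (sym px) tt)))
  hasCode-unique : ∀ c x y → T (hasCode c x) → T (hasCode c y) → x ≡ y
  hasCode-unique c x y hx hy with T-∧⁻ {p x} hx | T-∧⁻ {p y} hy
  ... | px , cx | py , cy = code-inj x y px py (trans (toWitness cx) (sym (toWitness cy)))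

-- The two orientations of the step from a to b are counted separately, so that summing
-- over all (u , v) gives exactly 2 per step.
traverses : ∀ {n} → (a b u v : Fin n) → ℕ
traverses a b u v = 𝟙 (⌊ a ≟F u ⌋ ∧ ⌊ b ≟F v ⌋) + 𝟙 (⌊ a ≟F v ⌋ ∧ ⌊ b ≟F u ⌋)

traversals : ∀ {n} → List (Fin n) → (u v : Fin n) → ℕ
traversals (a ∷ b ∷ l) u v = traverses a b u v + traversals (b ∷ l) u v
traversals _           u v = 0

module _ {n : ℕ} where

  ∑-𝟙-≟ : ∀ (a : Fin n) → ∑[ u ∈ allFin n ] 𝟙 ⌊ a ≟F u ⌋ ≡ 1
  ∑-𝟙-≟ a = ≤-antisym
    (∑-𝟙≤1 (λ u → ⌊ a ≟F u ⌋) (allFin⁺ n) (λ u v a≡u a≡v → trans (sym (toWitness a≡u)) (toWitness a≡v)))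
    (≤-trans (≤-reflexive (sym (𝟙-true (fromWitness refl)))) (∈⇒≤∑ (λ u → 𝟙 ⌊ a ≟F u ⌋) (∈-allFin a)))

  ∑∑-𝟙-≟∧≟ : ∀ (a b : Fin n) → ∑[ u ∈ allFin n ] ∑[ v ∈ allFin n ] 𝟙 (⌊ a ≟F u ⌋ ∧ ⌊ b ≟F v ⌋) ≡ 1
  ∑∑-𝟙-≟∧≟ a b = begin
    ∑[ u ∈ allFin n ] ∑[ v ∈ allFin n ] 𝟙 (⌊ a ≟F u ⌋ ∧ ⌊ b ≟F v ⌋)
      ≡⟨ ∑-cong (allFin n) (λ u → ∑-cong (allFin n) (λ v → 𝟙-∧ ⌊ a ≟F u ⌋ ⌊ b ≟F v ⌋)) ⟩
    ∑[ u ∈ allFin n ] ∑[ v ∈ allFin n ] (𝟙 ⌊ a ≟F u ⌋ * 𝟙 ⌊ b ≟F v ⌋)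
      ≡⟨ ∑-cong (allFin n) (λ u → *-distribˡ-∑ (𝟙 ⌊ a ≟F u ⌋) (allFin n) _) ⟨
    ∑[ u ∈ allFin n ] (𝟙 ⌊ a ≟F u ⌋ * ∑[ v ∈ allFin n ] 𝟙 ⌊ b ≟F v ⌋)
      ≡⟨ ∑-cong (allFin n) (λ u → trans (cong (𝟙 ⌊ a ≟F u ⌋ *_) (∑-𝟙-≟ b)) (*-identityʳ _)) ⟩
    ∑[ u ∈ allFin n ] 𝟙 ⌊ a ≟F u ⌋
      ≡⟨ ∑-𝟙-≟ a ⟩
    1 ∎
    where open ≡-Reasoning

  ∑∑-traverses : ∀ (a b : Fin n) → ∑[ u ∈ allFin n ] ∑[ v ∈ allFin n ] traverses a b u v ≡ 2
  ∑∑-traverses a b = begin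
    ∑[ u ∈ allFin n ] ∑[ v ∈ allFin n ] traverses a b u v
      ≡⟨ ∑-cong (allFin n) (λ u → ∑-distrib-+ (allFin n) _ _) ⟩
    ∑[ u ∈ allFin n ] (∑[ v ∈ allFin n ] 𝟙 (⌊ a ≟F u ⌋ ∧ ⌊ b ≟F v ⌋) + ∑[ v ∈ allFin n ] 𝟙 (⌊ a ≟F v ⌋ ∧ ⌊ b ≟F u ⌋))
      ≡⟨ ∑-distrib-+ (allFin n) _ _ ⟩
    ∑[ u ∈ allFin n ] ∑[ v ∈ allFin n ] 𝟙 (⌊ a ≟F u ⌋ ∧ ⌊ b ≟F v ⌋) + ∑[ u ∈ allFin n ] ∑[ v ∈ allFin n ] 𝟙 (⌊ a ≟F v ⌋ ∧ ⌊ b ≟F u ⌋)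
      ≡⟨ cong₂ _+_ (∑∑-𝟙-≟∧≟ a b) (trans (∑-comm (allFin n) (allFin n) _) (∑∑-𝟙-≟∧≟ a b)) ⟩
    2 ∎
    where open ≡-Reasoning

  ∑∑-traversals : ∀ (l : List (Fin n)) → ∑[ u ∈ allFin n ] ∑[ v ∈ allFin n ] traversals l u v ≡ 2 * (length l ∸ 1)
  ∑∑-traversals []          = trans (∑-cong (allFin n) (λ _ → ∑-zero (allFin n))) (∑-zero (allFin n))
  ∑∑-traversals (a ∷ [])    = trans (∑-cong (allFin n) (λ _ → ∑-zero (allFin n))) (∑-zero (allFin n))
  ∑∑-traversals (a ∷ b ∷ l) = begin
    ∑[ u ∈ allFin n ] ∑[ v ∈ allFin n ] (traverses a b u v + traversals (b ∷ l) u v)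
      ≡⟨ ∑-cong (allFin n) (λ u → ∑-distrib-+ (allFin n) _ _) ⟩
    ∑[ u ∈ allFin n ] (∑[ v ∈ allFin n ] traverses a b u v + ∑[ v ∈ allFin n ] traversals (b ∷ l) u v)
      ≡⟨ ∑-distrib-+ (allFin n) _ _ ⟩
    ∑[ u ∈ allFin n ] ∑[ v ∈ allFin n ] traverses a b u v + ∑[ u ∈ allFin n ] ∑[ v ∈ allFin n ] traversals (b ∷ l) u v
      ≡⟨ cong₂ _+_ (∑∑-traverses a b) (∑∑-traversals (b ∷ l)) ⟩
    2 + 2 * length l
      ≡⟨ *-suc 2 (length l) ⟨
    2 * suc (length l) ∎
    where open ≡-Reasoning

  ≟∧≟⇒≡ : ∀ {a b u v : Fin n} → T (⌊ a ≟F u ⌋ ∧ ⌊ b ≟F v ⌋) → a ≡ u × b ≡ v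
  ≟∧≟⇒≡ {a} {b} {u} {v} t with p , q ← T-∧⁻ {⌊ a ≟F u ⌋} t = toWitness p , toWitness q

  traverses≡0 : ∀ {z a b u v : Fin n} → z ≢ a → z ≢ b → z ≡ u ⊎ z ≡ v → traverses a b u v ≡ 0
  traverses≡0 {z} {a} {b} {u} {v} z≢a z≢b z∈uv = cong₂ _+_ (𝟙-false forward) (𝟙-false backward)
    where
    forward : ¬ T (⌊ a ≟F u ⌋ ∧ ⌊ b ≟F v ⌋)
    forward t with ≟∧≟⇒≡ {a} {b} {u} {v} t
    ... | refl , refl = [ z≢a , z≢b ]′ z∈uv
    backward : ¬ T (⌊ a ≟F v ⌋ ∧ ⌊ b ≟F u ⌋)
    backward t with ≟∧≟⇒≡ {a} {b} {v} {u} t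
    ... | refl , refl = [ z≢b , z≢a ]′ z∈uv

  traversals≡0 : ∀ {z u v : Fin n} l → All (z ≢_) l → z ≡ u ⊎ z ≡ v → traversals l u v ≡ 0
  traversals≡0 []          _                  _    = refl
  traversals≡0 (a ∷ [])    _                  _    = refl
  traversals≡0 (a ∷ b ∷ l) (z≢a ∷ z≢b ∷ z∉l) z∈uv =
    cong₂ _+_ (traverses≡0 z≢a z≢b z∈uv) (traversals≡0 (b ∷ l) (z≢b ∷ z∉l) z∈uv)

  traversals≤𝟙-usesEdge : ∀ {l : List (Fin n)} u v → Unique l → traversals l u v ≤ 𝟙 (usesEdge u v l)
  traversals≤𝟙-usesEdge {[]}        u v _              = z≤n
  traversals≤𝟙-usesEdge {a ∷ []}    u v _              = z≤n
  traversals≤𝟙-usesEdge {a ∷ b ∷ l} u v (a∉ ∷ b∷l-uniq) =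
    first-step (⌊ a ≟F u ⌋ ∧ ⌊ b ≟F v ⌋) (⌊ a ≟F v ⌋ ∧ ⌊ b ≟F u ⌋) not-both rest-unused
               (traversals≤𝟙-usesEdge u v b∷l-uniq)
    where
    first-step : ∀ c₁ c₂ {U t} → ¬ (T c₁ × T c₂) → (T (c₁ ∨ c₂) → t ≡ 0) → t ≤ 𝟙 U →
                 𝟙 c₁ + 𝟙 c₂ + t ≤ 𝟙 ((c₁ ∨ c₂) ∨ U)
    first-step false false _      _    t≤U = t≤U
    first-step true  true  ¬both  _    _   = contradiction (tt , tt) ¬both
    first-step true  false _      t≡0  _   = ≤-reflexive (cong suc (t≡0 tt))
    first-step false true  _      t≡0  _   = ≤-reflexive (cong suc (t≡0 tt))
    not-both : ¬ (T (⌊ a ≟F u ⌋ ∧ ⌊ b ≟F v ⌋) × T (⌊ a ≟F v ⌋ ∧ ⌊ b ≟F u ⌋))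
    not-both (t₁ , t₂) with ≟∧≟⇒≡ {a} {b} {u} {v} t₁ | ≟∧≟⇒≡ {a} {b} {v} {u} t₂
    ... | refl , _ | _ , refl = All.head a∉ refl
    rest-unused : T ((⌊ a ≟F u ⌋ ∧ ⌊ b ≟F v ⌋) ∨ (⌊ a ≟F v ⌋ ∧ ⌊ b ≟F u ⌋)) → traversals (b ∷ l) u v ≡ 0
    rest-unused t with ⌊ a ≟F u ⌋ ∧ ⌊ b ≟F v ⌋ in eq
    ... | true  = traversals≡0 (b ∷ l) a∉ (inj₁ (proj₁ (≟∧≟⇒≡ {a} {b} {u} {v} (subst T (sym eq) tt))))
    ... | false = traversals≡0 (b ∷ l) a∉ (inj₂ (proj₁ (≟∧≟⇒≡ {a} {b} {v} {u} t)))

  module _ {r} {R : Rel (Fin n) r} (R-sym : Symmetric R) (R? : Decidable R) where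

    traverses≡0-¬R : ∀ {a b u v} → R a b → ¬ R u v → traverses a b u v ≡ 0
    traverses≡0-¬R {a} {b} {u} {v} Rab ¬Ruv = cong₂ _+_ (𝟙-false forward) (𝟙-false backward)
      where
      forward : ¬ T (⌊ a ≟F u ⌋ ∧ ⌊ b ≟F v ⌋)
      forward t with refl , refl ← ≟∧≟⇒≡ {a} {b} {u} {v} t = ¬Ruv Rab
      backward : ¬ T (⌊ a ≟F v ⌋ ∧ ⌊ b ≟F u ⌋)
      backward t with refl , refl ← ≟∧≟⇒≡ {a} {b} {v} {u} t = ¬Ruv (R-sym Rab)

    traversals≡0-¬R : ∀ {l u v} → Linked R l → ¬ R u v → traversals l u v ≡ 0
    traversals≡0-¬R []            _   = refl
    traversals≡0-¬R [-]           _   = refl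
    traversals≡0-¬R (Rab ∷ R-rest) ¬R = cong₂ _+_ (traverses≡0-¬R Rab ¬R) (traversals≡0-¬R R-rest ¬R)

    2*length≤∑∑-usesEdge : ∀ {l} → Linked R l → Unique l →
      2 * (length l ∸ 1) ≤ ∑[ u ∈ allFin n ] ∑[ v ∈ allFin n ] (if ⌊ R? u v ⌋ then 𝟙 (usesEdge u v l) else 0)
    2*length≤∑∑-usesEdge {l} linked uniq = begin
      2 * (length l ∸ 1)                                    ≡⟨ ∑∑-traversals l ⟨
      ∑[ u ∈ allFin n ] ∑[ v ∈ allFin n ] traversals l u v  ≤⟨ ∑-mono-≤ (allFin n) (λ u → ∑-mono-≤ (allFin n) (traversals≤ u)) ⟩
      ∑[ u ∈ allFin n ] ∑[ v ∈ allFin n ] (if ⌊ R? u v ⌋ then 𝟙 (usesEdge u v l) else 0) ∎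
      where
      open ≤-Reasoning
      traversals≤ : ∀ u v → traversals l u v ≤ (if ⌊ R? u v ⌋ then 𝟙 (usesEdge u v l) else 0)
      traversals≤ u v with R? u v
      ... | yes _   = traversals≤𝟙-usesEdge u v uniq
      ... | no ¬Ruv = ≤-reflexive (traversals≡0-¬R linked ¬Ruv)

𝟙<+𝟙≥ : ∀ r m → 𝟙 ⌊ r <? m ⌋ + 𝟙 ⌊ m ≤? r ⌋ ≡ 1
𝟙<+𝟙≥ r m with r <? m
... | yes r<m = cong suc (𝟙-false (λ m≤r → <⇒≱ r<m (toWitness m≤r)))
... | no  r≮m = 𝟙-true (fromWitness (≮⇒≥ r≮m))

pad-length : ∀ {m r} → m ≤ r → m + 2 * ((r ∸ m) / 2) ≡ r ∸ (r ∸ m) % 2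
pad-length {m} {r} m≤r = begin
  m + 2 * j                   ≡⟨ m+n∸n≡m (m + 2 * j) (t % 2) ⟨
  m + 2 * j + t % 2 ∸ t % 2   ≡⟨ cong (_∸ t % 2) padded ⟩
  r ∸ t % 2                   ∎
  where
  open ≡-Reasoning
  t : ℕ
  t = r ∸ m
  j : ℕ
  j = t / 2
  padded : m + 2 * j + t % 2 ≡ r
  padded = begin
    m + 2 * j + t % 2     ≡⟨ shuffle m j (t % 2) ⟩
    m + (t % 2 + j * 2)   ≡⟨ cong (m +_) (m≡m%n+[m/n]*n t 2) ⟨
    m + t                 ≡⟨ m+[n∸m]≡n m≤r ⟩
    r                     ∎
    where
    shuffle : ∀ a b c → a + 2 * b + c ≡ a + (c + b * 2)
    shuffle = solve-∀

r∸parity∈ : ∀ r {b} → b < 2 → r ∸ b ∈ (r ∸ 1 ∷ r ∷ [])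
r∸parity∈ r {0} _ = there (here refl)
r∸parity∈ r {1} _ = here refl
r∸parity∈ r {suc (suc _)} (s≤s (s≤s ()))

ballComplementSum : ℕ → ℕ → ℕ
ballComplementSum n K = ∑[ r ∈ upTo K ] (n ∸ 2 * (suc r * suc r))

ballComplementSum≤∑ : ∀ {a} {A : Set a} (xs : List A) (d : A → ℕ) →
  (∀ r → ∑[ y ∈ xs ] 𝟙 ⌊ d y ≤? r ⌋ ≤ 2 * (suc r * suc r)) →
  ∀ K → ballComplementSum (length xs) K ≤ ∑ xs d
ballComplementSum≤∑ xs d ball K = begin
  ∑[ r ∈ upTo K ] (length xs ∸ 2 * (suc r * suc r)) ≤⟨ ∑-mono-≤ (upTo K) outside ⟩
  ∑[ r ∈ upTo K ] ∑[ y ∈ xs ] 𝟙 ⌊ r <? d y ⌋        ≡⟨ ∑-comm (upTo K) xs _ ⟩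
  ∑[ y ∈ xs ] ∑[ r ∈ upTo K ] 𝟙 ⌊ r <? d y ⌋        ≤⟨ ∑-mono-≤ xs (λ y → ≤-trans (≤-reflexive (∑-upTo-𝟙< K (d y))) (m⊓n≤n K (d y))) ⟩
  ∑ xs d                                             ∎
  where
  open ≤-Reasoning
  outside : ∀ r → length xs ∸ 2 * (suc r * suc r) ≤ ∑[ y ∈ xs ] 𝟙 ⌊ r <? d y ⌋
  outside r = begin
    length xs ∸ 2 * (suc r * suc r) ≤⟨ ∸-monoʳ-≤ (length xs) (ball r) ⟩
    length xs ∸ inside               ≡⟨ cong (_∸ inside) split ⟨
    beyond + inside ∸ inside         ≡⟨ m+n∸n≡m beyond inside ⟩
    beyond                           ∎
    where
    beyond : ℕ
    beyond = ∑[ y ∈ xs ] 𝟙 ⌊ r <? d y ⌋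
    inside : ℕ
    inside = ∑[ y ∈ xs ] 𝟙 ⌊ d y ≤? r ⌋
    split : beyond + inside ≡ length xs
    split = trans (sym (∑-distrib-+ xs _ _))
                  (trans (∑-cong xs (λ y → 𝟙<+𝟙≥ r (d y))) (trans (∑-const xs 1) (*-identityʳ _)))

ballComplementSum-closedForm : ∀ n K → 2 * (K * K) ≤ n →
  6 * ballComplementSum n K + 2 * K * (K + 1) * (2 * K + 1) ≡ 6 * K * n
ballComplementSum-closedForm n zero    _     = refl
ballComplementSum-closedForm n (suc K) 2K²≤n with u , refl ← m≤n⇒∃[o]m+o≡n 2K²≤n =
  +-cancelʳ-≡ (Q K) _ _ (begin
    6 * ballComplementSum N (suc K) + Q (suc K) + Q K   ≡⟨ cong (λ b → 6 * b + Q (suc K) + Q K) (∑-upTo-suc K _) ⟩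
    6 * (B + (N ∸ 2 * (suc K * suc K))) + Q (suc K) + Q K ≡⟨ cong (λ x → 6 * (B + x) + Q (suc K) + Q K) (m+n∸m≡n (2 * (suc K * suc K)) u) ⟩
    6 * (B + u) + Q (suc K) + Q K                       ≡⟨ regroup B u (Q (suc K)) (Q K) ⟩
    (6 * B + Q K) + 6 * u + Q (suc K)                   ≡⟨ cong (λ x → x + 6 * u + Q (suc K)) (ballComplementSum-closedForm N K 2K²≤N) ⟩
    6 * K * N + 6 * u + Q (suc K)                       ≡⟨ step K u ⟩
    6 * suc K * N + Q K                                 ∎)
  where
  open ≡-Reasoning
  Q : ℕ → ℕ
  Q k = 2 * k * (k + 1) * (2 * k + 1)
  N : ℕ
  N = 2 * (suc K * suc K) + u
  B : ℕ
  B = ballComplementSum N K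
  2K²≤N : 2 * (K * K) ≤ N
  2K²≤N = ≤-trans (*-monoʳ-≤ 2 (*-mono-≤ (n≤1+n K) (n≤1+n K))) (m≤m+n _ u)
  regroup : ∀ b u q q′ → 6 * (b + u) + q + q′ ≡ (6 * b + q′) + 6 * u + q
  regroup = solve-∀
  step : ∀ K u → 6 * K * (2 * ((1 + K) * (1 + K)) + u) + 6 * u + 2 * (1 + K) * ((1 + K) + 1) * (2 * (1 + K) + 1) ≡
                 6 * (1 + K) * (2 * ((1 + K) * (1 + K)) + u) + 2 * K * (K + 1) * (2 * K + 1)
  step = solve-∀

-- Since (√(2n) − 7)³ = √(2n) (2n + 147) − (42n + 343), this is the paper's bound
-- (n − 1)(√(2n) − 7)³ ≤ 12 n M with √(2n) isolated and both sides squared.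
ForwardingBound : ℕ → ℕ → Set
ForwardingBound n M = 2 * n * ((n ∸ 1) * (2 * n + 147)) ^ 2 ≤ (12 * n * M + (n ∸ 1) * (42 * n + 343)) ^ 2

forwardingBound-large : ∀ k t M → let K = 5 + k ; n = 2 * (K * K) + t in
  n < 2 * (suc K * suc K) → ballComplementSum n K ≤ 2 * M → ForwardingBound n M
forwardingBound-large k t M n<2[K+1]² B≤2M = begin
  2 * n * (m * Y) ^ 2           ≤⟨ *-monoˡ-≤ ((m * Y) ^ 2) 2n≤[2K+2]² ⟩
  (2 * K + 2) ^ 2 * (m * Y) ^ 2 ≡⟨ square-* (2 * K + 2) (m * Y) ⟩
  (m * Y * (2 * K + 2)) ^ 2     ≤⟨ ^-monoˡ-≤ 2 scaled ⟩
  (12 * n * M + m * (42 * n + 343)) ^ 2 ∎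
  where
  open ≤-Reasoning
  K : ℕ
  K = 5 + k
  n : ℕ
  n = 2 * (K * K) + t
  m : ℕ
  m = n ∸ 1
  Y : ℕ
  Y = 2 * n + 147
  B : ℕ
  B = ballComplementSum n K
  slack : ℕ
  slack = 270 + 404 * k + 70 * (k * k) + 2 * (K * t) + 38 * t + 49
  linear : Y * (2 * K + 2) ≤ 6 * B + (42 * n + 343)
  linear = +-cancelʳ-≤ (2 * K * (K + 1) * (2 * K + 1)) _ _ (begin
    Y * (2 * K + 2) + 2 * K * (K + 1) * (2 * K + 1)          ≤⟨ m≤m+n _ slack ⟩
    Y * (2 * K + 2) + 2 * K * (K + 1) * (2 * K + 1) + slack  ≡⟨ expand k t ⟩
    6 * K * n + (42 * n + 343)                                ≡⟨ cong (_+ (42 * n + 343)) (ballComplementSum-closedForm n K (m≤m+n _ t)) ⟨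
    6 * B + 2 * K * (K + 1) * (2 * K + 1) + (42 * n + 343)    ≡⟨ +-+-swap (6 * B) _ (42 * n + 343) ⟩
    6 * B + (42 * n + 343) + 2 * K * (K + 1) * (2 * K + 1)    ∎)
    where
    -- The slack is 70K² − 296K + 2Kt + 38t + 49, written in k = K − 5 to make it visibly nonnegative.
    expand : ∀ k t → (2 * (2 * ((5 + k) * (5 + k)) + t) + 147) * (2 * (5 + k) + 2) +
                     2 * (5 + k) * ((5 + k) + 1) * (2 * (5 + k) + 1) +
                     (270 + 404 * k + 70 * (k * k) + 2 * ((5 + k) * t) + 38 * t + 49) ≡
                     6 * (5 + k) * (2 * ((5 + k) * (5 + k)) + t) + (42 * (2 * ((5 + k) * (5 + k)) + t) + 343)
    expand = solve-∀
    +-+-swap : ∀ a b c → a + b + c ≡ a + c + b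
    +-+-swap = solve-∀
  scaled : m * Y * (2 * K + 2) ≤ 12 * n * M + m * (42 * n + 343)
  scaled = begin
    m * Y * (2 * K + 2)                 ≡⟨ *-assoc m Y (2 * K + 2) ⟩
    m * (Y * (2 * K + 2))               ≤⟨ *-monoʳ-≤ m linear ⟩
    m * (6 * B + (42 * n + 343))        ≡⟨ *-distribˡ-+ m (6 * B) _ ⟩
    m * (6 * B) + m * (42 * n + 343)    ≤⟨ +-monoˡ-≤ _ (*-mono-≤ (m∸n≤m n 1) (*-monoʳ-≤ 6 B≤2M)) ⟩
    n * (6 * (2 * M)) + m * (42 * n + 343) ≡⟨ cong (_+ m * (42 * n + 343)) (twelve n M) ⟩
    12 * n * M + m * (42 * n + 343)     ∎
    where
    twelve : ∀ n M → n * (6 * (2 * M)) ≡ 12 * n * M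
    twelve = solve-∀
  2n≤[2K+2]² : 2 * n ≤ (2 * K + 2) ^ 2
  2n≤[2K+2]² = ≤-trans (*-monoʳ-≤ 2 (<⇒≤ n<2[K+1]²)) (≤-reflexive (double-square K))
    where
    double-square : ∀ x → 2 * (2 * ((1 + x) * (1 + x))) ≡ (2 * x + 2) * ((2 * x + 2) * 1)
    double-square = solve-∀
  square-* : ∀ a b → a * (a * 1) * (b * (b * 1)) ≡ b * a * (b * a * 1)
  square-* = solve-∀

forwardingBound-small : ∀ n M → n < 50 → n ∸ 2 ≤ 2 * M → ForwardingBound n M
forwardingBound-small n M n<50 n∸2≤2M =
  ≤-trans (All.lookup table (∈-upTo⁺ n<50))
          (^-monoˡ-≤ 2 (+-monoˡ-≤ _ (≤-trans (*-monoʳ-≤ (6 * n) n∸2≤2M) (≤-reflexive (twelve n M)))))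
  where
  table : All (λ n → 2 * n * ((n ∸ 1) * (2 * n + 147)) ^ 2 ≤ (6 * n * (n ∸ 2) + (n ∸ 1) * (42 * n + 343)) ^ 2)
              (upTo 50)
  table = toWitness {a? = all? (λ n → _ ≤? _) (upTo 50)} tt
  twelve : ∀ n M → 6 * n * (2 * M) ≡ 12 * n * M
  twelve = solve-∀

doubleSquare-bracket : ∀ n → ∃[ K ] 2 * (K * K) ≤ n × n < 2 * (suc K * suc K)
doubleSquare-bracket zero = 0 , z≤n , s≤s z≤n
doubleSquare-bracket (suc n) with K , 2K²≤n , n<2[K+1]² ← doubleSquare-bracket n | suc n <? 2 * (suc K * suc K)
... | yes below = K , m≤n⇒m≤1+n 2K²≤n , below
... | no  above = suc K , ≮⇒≥ above , ≤-<-trans n<2[K+1]² (≤-trans (m≤m+n _ (4 * K + 5)) (≤-reflexive (next-square K)))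
  where
  next-square : ∀ K → 1 + 2 * ((1 + K) * (1 + K)) + (4 * K + 5) ≡ 2 * ((2 + K) * (2 + K))
  next-square = solve-∀

forwardingBound : ∀ n M → (∀ K → ballComplementSum n K ≤ 2 * M) → ForwardingBound n M
forwardingBound n M B≤2M with n <? 50
... | yes n<50 = forwardingBound-small n M n<50 (≤-trans (≤-reflexive (sym (+-identityʳ (n ∸ 2)))) (B≤2M 1))
... | no  n≮50 with K , 2K²≤n , n<2[K+1]² ← doubleSquare-bracket n | 5 ≤? K
...   | no  K≱5 = contradiction (<-≤-trans n<2[K+1]² (*-monoʳ-≤ 2 (*-mono-≤ K+1≤5 K+1≤5))) n≮50
  where
  K+1≤5 : suc K ≤ 5
  K+1≤5 = s≤s (≮⇒≥ K≱5)
...   | yes K≥5 with k , refl ← m≤n⇒∃[o]m+o≡n K≥5 | t , refl ← m≤n⇒∃[o]m+o≡n 2K²≤n =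
  forwardingBound-large k t M n<2[K+1]² (B≤2M (5 + k))

module Circulant (n s : ℕ) .{{_ : NonZero n}} (s≤n : s ≤ n) where

  1≤n : 1 ≤ n
  1≤n = >-nonZero⁻¹ n

  infix 4 _≈_
  _≈_ : ℕ → ℕ → Set
  a ≈ b = a % n ≡ b % n

  ≡⇒≈ : ∀ {a b} → a ≡ b → a ≈ b
  ≡⇒≈ = cong (_% n)

  +-cong-≈ : ∀ {a b c d} → a ≈ b → c ≈ d → a + c ≈ b + d
  +-cong-≈ {a} {b} {c} {d} a≈b c≈d = begin
    (a + c) % n             ≡⟨ %-distribˡ-+ a c n ⟩
    (a % n + c % n) % n     ≡⟨ cong₂ (λ x y → (x + y) % n) a≈b c≈d ⟩
    (b % n + d % n) % n     ≡⟨ %-distribˡ-+ b d n ⟨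
    (b + d) % n             ∎
    where open ≡-Reasoning

  +n-≈ : ∀ a → a + n ≈ a
  +n-≈ a = [m+n]%n≡m%n a n

  +-cancelʳ-≈ : ∀ a b c → a + c ≈ b + c → a ≈ b
  +-cancelʳ-≈ a b c a+c≈b+c = begin
    a % n                     ≡⟨ [m+kn]%n≡m%n a c n ⟨
    (a + c * n) % n           ≡⟨ ≡⇒≈ (add-multiple a) ⟨
    (a + c + c * (n ∸ 1)) % n ≡⟨ +-cong-≈ a+c≈b+c refl ⟩
    (b + c + c * (n ∸ 1)) % n ≡⟨ ≡⇒≈ (add-multiple b) ⟩
    (b + c * n) % n           ≡⟨ [m+kn]%n≡m%n b c n ⟩
    b % n                     ∎
    where
    open ≡-Reasoning
    add-multiple : ∀ x → x + c + c * (n ∸ 1) ≡ x + c * n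
    add-multiple x = trans (regroup x c (n ∸ 1)) (cong (λ m → x + c * m) (m+[n∸m]≡n 1≤n))
      where
      regroup : ∀ x c m → x + c + c * m ≡ x + c * (1 + m)
      regroup = solve-∀

  toℕ-≈-injective : ∀ {a b : Fin n} → toℕ a ≈ toℕ b → a ≡ b
  toℕ-≈-injective {a} {b} a≈b =
    toℕ-injective (trans (sym (m<n⇒m%n≡m (toℕ<n a))) (trans a≈b (m<n⇒m%n≡m (toℕ<n b))))

  StepBy⇒≈ : ∀ {d} {a b : Fin n} → StepBy n d a b → toℕ a + d ≈ toℕ b
  StepBy⇒≈ (inj₁ a+d≡b)   = ≡⇒≈ a+d≡b
  StepBy⇒≈ {d} {a} {b} (inj₂ a+d≡b+n) = trans (≡⇒≈ a+d≡b+n) (+n-≈ (toℕ b))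

  StepBy-back⇒≈ : ∀ {e} {a b : Fin n} → e ≤ n → StepBy n (n ∸ e) a b → toℕ b + e ≈ toℕ a
  StepBy-back⇒≈ {e} {a} {b} e≤n step = begin
    (toℕ b + e) % n             ≡⟨ +-cong-≈ (StepBy⇒≈ {n ∸ e} {a} {b} step) refl ⟨
    (toℕ a + (n ∸ e) + e) % n   ≡⟨ ≡⇒≈ (trans (+-assoc (toℕ a) (n ∸ e) e) (cong (toℕ a +_) (m∸n+n≡m e≤n))) ⟩
    (toℕ a + n) % n             ≡⟨ +n-≈ (toℕ a) ⟩
    toℕ a % n                   ∎
    where open ≡-Reasoning

  StepBy-functional : ∀ {d} {u v v′ : Fin n} → StepBy n d u v → StepBy n d u v′ → v ≡ v′
  StepBy-functional {d} {u} {v} {v′} p q =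
    toℕ-≈-injective (trans (sym (StepBy⇒≈ {d} {u} {v} p)) (StepBy⇒≈ {d} {u} {v′} q))

  StepBy-sym : ∀ {d} {a b : Fin n} → d ≤ n → StepBy n d a b → StepBy n (n ∸ d) b a
  StepBy-sym {d} {a} {b} d≤n (inj₁ a+d≡b) = inj₂ (begin
    toℕ b + (n ∸ d)       ≡⟨ cong (_+ (n ∸ d)) a+d≡b ⟨
    toℕ a + d + (n ∸ d)   ≡⟨ +-assoc (toℕ a) d (n ∸ d) ⟩
    toℕ a + (d + (n ∸ d)) ≡⟨ cong (toℕ a +_) (m+[n∸m]≡n d≤n) ⟩
    toℕ a + n             ∎)
    where open ≡-Reasoning
  StepBy-sym {d} {a} {b} d≤n (inj₂ a+d≡b+n) = inj₁ (+-cancelʳ-≡ d _ _ (begin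
    toℕ b + (n ∸ d) + d   ≡⟨ +-assoc (toℕ b) (n ∸ d) d ⟩
    toℕ b + (n ∸ d + d)   ≡⟨ cong (toℕ b +_) (m∸n+n≡m d≤n) ⟩
    toℕ b + n             ≡⟨ a+d≡b+n ⟨
    toℕ a + d             ∎))
    where open ≡-Reasoning

  StepBy-back-sym : ∀ {d} {a b : Fin n} → d ≤ n → StepBy n (n ∸ d) a b → StepBy n d b a
  StepBy-back-sym {d} d≤n step = subst (λ e → StepBy n e _ _) (m∸[m∸n]≡n d≤n) (StepBy-sym (m∸n≤m n d) step)

  Adj-sym : Symmetric (Adj n s)
  Adj-sym (inj₁ step)               = inj₂ (inj₁ (StepBy-sym 1≤n step))
  Adj-sym (inj₂ (inj₁ step))        = inj₁ (StepBy-back-sym 1≤n step)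
  Adj-sym (inj₂ (inj₂ (inj₁ step))) = inj₂ (inj₂ (inj₂ (StepBy-sym s≤n step)))
  Adj-sym (inj₂ (inj₂ (inj₂ step))) = inj₂ (inj₂ (inj₁ (StepBy-back-sym s≤n step)))

  stepLengths : List ℕ
  stepLengths = 1 ∷ n ∸ 1 ∷ s ∷ n ∸ s ∷ []

  Adj⇒StepBy : ∀ {a b} → Adj n s a b → ∃[ d ] d ∈ stepLengths × StepBy n d a b
  Adj⇒StepBy (inj₁ step)               = 1     , here refl                         , step
  Adj⇒StepBy (inj₂ (inj₁ step))        = n ∸ 1 , there (here refl)                 , step
  Adj⇒StepBy (inj₂ (inj₂ (inj₁ step))) = s     , there (there (here refl))         , step
  Adj⇒StepBy (inj₂ (inj₂ (inj₂ step))) = n ∸ s , there (there (there (here refl))) , step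

  degree≤4 : ∀ u → ∑[ v ∈ allFin n ] 𝟙 ⌊ adj? n s u v ⌋ ≤ 4
  degree≤4 u = begin
    ∑[ v ∈ allFin n ] 𝟙 ⌊ adj? n s u v ⌋                            ≤⟨ ∑-mono-≤ (allFin n) 𝟙-adj≤ ⟩
    ∑[ v ∈ allFin n ] ∑[ d ∈ stepLengths ] 𝟙 ⌊ stepBy? n d u v ⌋    ≡⟨ ∑-comm (allFin n) stepLengths (λ v d → 𝟙 ⌊ stepBy? n d u v ⌋) ⟩
    ∑[ d ∈ stepLengths ] ∑[ v ∈ allFin n ] 𝟙 ⌊ stepBy? n d u v ⌋    ≤⟨ ∑-bounded stepLengths at-most-one ⟩
    4                                                                ∎
    where
    open ≤-Reasoning
    𝟙-adj≤ : ∀ v → 𝟙 ⌊ adj? n s u v ⌋ ≤ ∑[ d ∈ stepLengths ] 𝟙 ⌊ stepBy? n d u v ⌋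
    𝟙-adj≤ v with adj? n s u v
    ... | no  _   = z≤n
    ... | yes adj with d , d∈ , step ← Adj⇒StepBy adj =
      ≤-trans (≤-reflexive (sym (𝟙-true (fromWitness {a? = stepBy? n d u v} step))))
              (∈⇒≤∑ (λ d → 𝟙 ⌊ stepBy? n d u v ⌋) d∈)
    at-most-one : ∀ d → ∑[ v ∈ allFin n ] 𝟙 ⌊ stepBy? n d u v ⌋ ≤ 1
    at-most-one d = ∑-𝟙≤1 (λ v → ⌊ stepBy? n d u v ⌋) (allFin⁺ n)
      (λ v v′ p q → StepBy-functional {d} {u} {v} {v′} (toWitness p) (toWitness q))

  -- A walk of length L from x to y with P steps in {+1, +s} and Q steps in {+1, −s} satisfies
  -- y ≡ x + (P + Q − L) + (P − Q) s (mod n); Reaches is this congruence without subtraction.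
  record Reaches (x y : Fin n) (L P Q : ℕ) : Set where
    constructor reaches
    field congruence : toℕ y + (L + Q * s) ≈ toℕ x + (P + Q + P * s)

  Reaches-trans : ∀ {x y z L P Q L′ P′ Q′} → Reaches x y L P Q → Reaches y z L′ P′ Q′ →
                  Reaches x z (L + L′) (P + P′) (Q + Q′)
  Reaches-trans {x} {y} {z} {L} {P} {Q} {L′} {P′} {Q′} (reaches xy) (reaches yz) = reaches (begin
    (toℕ z + ((L + L′) + (Q + Q′) * s)) % n      ≡⟨ ≡⇒≈ (split-length (toℕ z) L L′ Q Q′ s) ⟩
    (toℕ z + (L′ + Q′ * s) + (L + Q * s)) % n    ≡⟨ +-cong-≈ yz refl ⟩
    (toℕ y + (P′ + Q′ + P′ * s) + (L + Q * s)) % n ≡⟨ ≡⇒≈ (swap (toℕ y) (P′ + Q′ + P′ * s) (L + Q * s)) ⟩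
    (toℕ y + (L + Q * s) + (P′ + Q′ + P′ * s)) % n ≡⟨ +-cong-≈ xy refl ⟩
    (toℕ x + (P + Q + P * s) + (P′ + Q′ + P′ * s)) % n ≡⟨ ≡⇒≈ (merge-counts (toℕ x) P Q P′ Q′ s) ⟩
    (toℕ x + ((P + P′) + (Q + Q′) + (P + P′) * s)) % n ∎)
    where
    open ≡-Reasoning
    split-length : ∀ z L L′ Q Q′ s → z + ((L + L′) + (Q + Q′) * s) ≡ z + (L′ + Q′ * s) + (L + Q * s)
    split-length = solve-∀
    swap : ∀ a b c → a + b + c ≡ a + c + b
    swap = solve-∀
    merge-counts : ∀ x P Q P′ Q′ s → x + (P + Q + P * s) + (P′ + Q′ + P′ * s) ≡ x + ((P + P′) + (Q + Q′) + (P + P′) * s)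
    merge-counts = solve-∀

  Reaches-roundTrips : ∀ y j → Reaches y y (2 * j) j j
  Reaches-roundTrips y j = reaches (≡⇒≈ (cong (toℕ y +_) (there-and-back j s)))
    where
    there-and-back : ∀ j s → 2 * j + j * s ≡ j + j + j * s
    there-and-back = solve-∀

  Reaches-injective : ∀ {x y y′ L P Q} → Reaches x y L P Q → Reaches x y′ L P Q → y ≡ y′
  Reaches-injective {x} {y} {y′} {L} {P} {Q} (reaches xy) (reaches xy′) =
    toℕ-≈-injective (+-cancelʳ-≈ (toℕ y) (toℕ y′) (L + Q * s) (trans xy (sym xy′)))

  Adj⇒Reaches : ∀ {a b} → Adj n s a b → ∃₂ λ p q → p ≤ 1 × q ≤ 1 × Reaches a b 1 p q
  Adj⇒Reaches {a} {b} (inj₁ step) = 1 , 1 , ≤-refl , ≤-refl , reaches (begin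
    (toℕ b + (1 + 1 * s)) % n         ≡⟨ +-cong-≈ (StepBy⇒≈ {1} {a} {b} step) refl ⟨
    (toℕ a + 1 + (1 + 1 * s)) % n     ≡⟨ ≡⇒≈ (forward (toℕ a) s) ⟩
    (toℕ a + (1 + 1 + 1 * s)) % n     ∎)
    where
    open ≡-Reasoning
    forward : ∀ a s → a + 1 + (1 + 1 * s) ≡ a + (1 + 1 + 1 * s)
    forward = solve-∀
  Adj⇒Reaches {a} {b} (inj₂ (inj₁ step)) =
    0 , 0 , z≤n , z≤n , reaches (trans (StepBy-back⇒≈ {1} {a} {b} 1≤n step) (≡⇒≈ (sym (+-identityʳ (toℕ a)))))
  Adj⇒Reaches {a} {b} (inj₂ (inj₂ (inj₁ step))) = 1 , 0 , ≤-refl , z≤n , reaches (begin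
    (toℕ b + (1 + 0 * s)) % n         ≡⟨ +-cong-≈ (StepBy⇒≈ {s} {a} {b} step) refl ⟨
    (toℕ a + s + (1 + 0 * s)) % n     ≡⟨ ≡⇒≈ (forward (toℕ a) s) ⟩
    (toℕ a + (1 + 0 + 1 * s)) % n     ∎)
    where
    open ≡-Reasoning
    forward : ∀ a s → a + s + (1 + 0 * s) ≡ a + (1 + 0 + 1 * s)
    forward = solve-∀
  Adj⇒Reaches {a} {b} (inj₂ (inj₂ (inj₂ step))) = 0 , 1 , z≤n , ≤-refl , reaches (begin
    (toℕ b + (1 + 1 * s)) % n         ≡⟨ ≡⇒≈ (backward (toℕ b) s) ⟩
    (toℕ b + s + 1) % n               ≡⟨ +-cong-≈ (StepBy-back⇒≈ {s} {a} {b} s≤n step) refl ⟩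
    (toℕ a + 1) % n                   ∎)
    where
    open ≡-Reasoning
    backward : ∀ b s → b + (1 + 1 * s) ≡ b + s + 1
    backward = solve-∀

  record ReachWitness (x y : Fin n) (L : ℕ) : Set where
    field
      P Q     : ℕ
      P≤L     : P ≤ L
      Q≤L     : Q ≤ L
      reached : Reaches x y L P Q

  ReachWitness-refl : ∀ {x} → ReachWitness x x 0
  ReachWitness-refl = record { P = 0 ; Q = 0 ; P≤L = z≤n ; Q≤L = z≤n ; reached = reaches refl }

  walk⇒ReachWitness : ∀ {a y l} → Linked (Adj n s) (a ∷ l) → last (a ∷ l) ≡ just y → ReachWitness a y (length l)
  walk⇒ReachWitness {l = []}    [-]          refl   = ReachWitness-refl
  walk⇒ReachWitness {l = _ ∷ _} (adj ∷ walk) last≡y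
    with p , q , p≤1 , q≤1 , step ← Adj⇒Reaches adj =
    record { P = p + P ; Q = q + Q ; P≤L = +-mono-≤ p≤1 P≤L ; Q≤L = +-mono-≤ q≤1 Q≤L
           ; reached = Reaches-trans step reached }
    where open ReachWitness (walk⇒ReachWitness walk last≡y)

  ball-bound : ∀ x (dist : Fin n → ℕ) → (∀ y → ReachWitness x y (dist y)) →
               ∀ r → ∑[ y ∈ allFin n ] 𝟙 ⌊ dist y ≤? r ⌋ ≤ 2 * (suc r * suc r)
  ball-bound x dist reach r = begin
    ∑[ y ∈ allFin n ] 𝟙 ⌊ dist y ≤? r ⌋
      ≤⟨ ∑𝟙≤length-by-injection (≡-dec _≟_ (≡-dec _≟_ _≟_)) codes (λ y → ⌊ dist y ≤? r ⌋) code
                                 (allFin⁺ n) code∈codes code-injective ⟩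
    length codes
      ≡⟨ length-codes ⟩
    2 * (suc r * suc r) ∎
    where
    open ≤-Reasoning
    open ReachWitness
    -- Padding by j round trips brings a walk of length ≤ r to length r ∸ 1 or r.
    j : Fin n → ℕ
    j y = (r ∸ dist y) / 2
    code : Fin n → ℕ × ℕ × ℕ
    code y = dist y + 2 * j y , P (reach y) + j y , Q (reach y) + j y
    codes : List (ℕ × ℕ × ℕ)
    codes = cartesianProduct (r ∸ 1 ∷ r ∷ []) (cartesianProduct (upTo (suc r)) (upTo (suc r)))
    length-codes : length codes ≡ 2 * (suc r * suc r)
    length-codes = trans (length-cartesianProduct (r ∸ 1 ∷ r ∷ []) (cartesianProduct (upTo (suc r)) (upTo (suc r))))
      (cong (2 *_) (trans (length-cartesianProduct (upTo (suc r)) (upTo (suc r)))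
                          (cong₂ _*_ (length-upTo (suc r)) (length-upTo (suc r)))))
    Reaches-at : Fin n → ℕ × ℕ × ℕ → Set
    Reaches-at y (L , P , Q) = Reaches x y L P Q
    code-reaches : ∀ y → Reaches-at y (code y)
    code-reaches y = Reaches-trans (reached (reach y)) (Reaches-roundTrips y (j y))
    code-injective : ∀ y y′ → T ⌊ dist y ≤? r ⌋ → T ⌊ dist y′ ≤? r ⌋ → code y ≡ code y′ → y ≡ y′
    code-injective y y′ _ _ same = Reaches-injective (code-reaches y) (subst (Reaches-at y′) (sym same) (code-reaches y′))
    code∈codes : ∀ y → T ⌊ dist y ≤? r ⌋ → code y ∈ codes
    code∈codes y d≤r = ∈-cartesianProduct⁺ L∈ (∈-cartesianProduct⁺ (∈-upTo⁺ (s≤s (padded≤r (P≤L (reach y)))))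
                                                                      (∈-upTo⁺ (s≤s (padded≤r (Q≤L (reach y))))))
      where
      L≡ : dist y + 2 * j y ≡ r ∸ (r ∸ dist y) % 2
      L≡ = pad-length (toWitness d≤r)
      L∈ : dist y + 2 * j y ∈ (r ∸ 1 ∷ r ∷ [])
      L∈ = subst (_∈ (r ∸ 1 ∷ r ∷ [])) (sym L≡) (r∸parity∈ r {(r ∸ dist y) % 2} (m%n<n (r ∸ dist y) 2))
      padded≤r : ∀ {c} → c ≤ dist y → c + j y ≤ r
      padded≤r {c} c≤d = begin
        c + j y                 ≤⟨ +-mono-≤ c≤d (m≤m+n (j y) (j y + 0)) ⟩
        dist y + 2 * j y        ≡⟨ L≡ ⟩
        r ∸ (r ∸ dist y) % 2    ≤⟨ m∸n≤m r ((r ∸ dist y) % 2) ⟩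
        r                       ∎

  module _ (R : AllToAllRouting n s) where

    routeLength : Fin n → Fin n → ℕ
    routeLength x y = if ⌊ x ≟F y ⌋ then 0 else length (route R x y) ∸ 1

    routeUses : (x y u v : Fin n) → ℕ
    routeUses x y u v = if ⌊ x ≟F y ⌋ then 0 else 𝟙 (usesEdge u v (route R x y))

    edgeLoad : Fin n → Fin n → ℕ
    edgeLoad u v = if ⌊ adj? n s u v ⌋ then load R u v else 0

    route-reach : ∀ x y → ReachWitness x y (routeLength x y)
    route-reach x y with x ≟F y
    ... | yes refl = ReachWitness-refl
    ... | no  x≢y  = path-reach (route R x y) (isPath R x y x≢y)
      where
      path-reach : ∀ l → IsPath n s x y l → ReachWitness x y (length l ∸ 1)
      path-reach []      (_ , _ , () , _)
      path-reach (_ ∷ l) (walk , _ , refl , last≡y) = walk⇒ReachWitness walk last≡y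

    2*routeLength≤ : ∀ x y →
      2 * routeLength x y ≤ ∑[ u ∈ allFin n ] ∑[ v ∈ allFin n ] (if ⌊ adj? n s u v ⌋ then routeUses x y u v else 0)
    2*routeLength≤ x y with x ≟F y
    ... | yes _   = z≤n
    ... | no  x≢y with walk , simple , _ ← isPath R x y x≢y = 2*length≤∑∑-usesEdge Adj-sym (adj? n s) walk simple

    edgeLoad≤maxLoad : ∀ u v → edgeLoad u v ≤ maxLoad R
    edgeLoad≤maxLoad u v = ≤-trans (∈⇒≤foldr-⊔ (edgeLoad u) (∈-allFin v))
      (∈⇒≤foldr-⊔ (λ u → foldr _⊔_ 0 (map (edgeLoad u) (allFin n))) (∈-allFin u))

    ∑∑-edgeLoad≤ : ∑[ u ∈ allFin n ] ∑[ v ∈ allFin n ] edgeLoad u v ≤ n * (4 * maxLoad R)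
    ∑∑-edgeLoad≤ = begin
      ∑[ u ∈ allFin n ] ∑[ v ∈ allFin n ] edgeLoad u v                   ≤⟨ ∑-mono-≤ (allFin n) (λ u → ∑-mono-≤ (allFin n) (edgeLoad≤ u)) ⟩
      ∑[ u ∈ allFin n ] ∑[ v ∈ allFin n ] (M * 𝟙 ⌊ adj? n s u v ⌋)       ≡⟨ ∑-cong (allFin n) (λ u → *-distribˡ-∑ M (allFin n) _) ⟨
      ∑[ u ∈ allFin n ] (M * ∑[ v ∈ allFin n ] 𝟙 ⌊ adj? n s u v ⌋)       ≤⟨ ∑-bounded (allFin n) (λ u → *-monoʳ-≤ M (degree≤4 u)) ⟩
      length (allFin n) * (M * 4)                                         ≡⟨ cong₂ _*_ (length-allFin n) (*-comm M 4) ⟩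
      n * (4 * M)                                                         ∎
      where
      open ≤-Reasoning
      M : ℕ
      M = maxLoad R
      edgeLoad≤ : ∀ u v → edgeLoad u v ≤ M * 𝟙 ⌊ adj? n s u v ⌋
      edgeLoad≤ u v with adj? n s u v | edgeLoad≤maxLoad u v
      ... | yes _ | ≤M = ≤-trans ≤M (≤-reflexive (sym (*-identityʳ M)))
      ... | no  _ | _  = z≤n

    2*∑∑routeLength≤∑∑edgeLoad :
      2 * ∑[ x ∈ allFin n ] ∑[ y ∈ allFin n ] routeLength x y ≤ ∑[ u ∈ allFin n ] ∑[ v ∈ allFin n ] edgeLoad u v
    2*∑∑routeLength≤∑∑edgeLoad = begin
      2 * ∑[ x ∈ allFin n ] ∑[ y ∈ allFin n ] routeLength x y
        ≡⟨ trans (*-distribˡ-∑ 2 (allFin n) _) (∑-cong (allFin n) (λ x → *-distribˡ-∑ 2 (allFin n) _)) ⟩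
      ∑[ x ∈ allFin n ] ∑[ y ∈ allFin n ] (2 * routeLength x y)
        ≤⟨ ∑-mono-≤ (allFin n) (λ x → ∑-mono-≤ (allFin n) (2*routeLength≤ x)) ⟩
      ∑[ x ∈ allFin n ] ∑[ y ∈ allFin n ] ∑[ u ∈ allFin n ] ∑[ v ∈ allFin n ] edgeUse x y u v
        ≡⟨ ∑∑-comm-∑∑ (allFin n) (allFin n) (allFin n) (allFin n) edgeUse ⟩
      ∑[ u ∈ allFin n ] ∑[ v ∈ allFin n ] ∑[ x ∈ allFin n ] ∑[ y ∈ allFin n ] edgeUse x y u v
        ≡⟨ ∑-cong (allFin n) (λ u → ∑-cong (allFin n) (λ v → ∑∑edgeUse≡edgeLoad u v)) ⟩
      ∑[ u ∈ allFin n ] ∑[ v ∈ allFin n ] edgeLoad u v ∎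
      where
      open ≤-Reasoning
      edgeUse : (x y u v : Fin n) → ℕ
      edgeUse x y u v = if ⌊ adj? n s u v ⌋ then routeUses x y u v else 0
      ∑∑edgeUse≡edgeLoad : ∀ u v → ∑[ x ∈ allFin n ] ∑[ y ∈ allFin n ] edgeUse x y u v ≡ edgeLoad u v
      ∑∑edgeUse≡edgeLoad u v = trans (∑-cong (allFin n) (λ x → ∑-if (allFin n) _ (λ y → routeUses x y u v)))
                               (∑-if (allFin n) _ (λ x → ∑[ y ∈ allFin n ] routeUses x y u v))

    ballComplementSum≤2*maxLoad : ∀ K → ballComplementSum n K ≤ 2 * maxLoad R
    ballComplementSum≤2*maxLoad K = *-cancelˡ-≤ 2 (*-cancelˡ-≤ n (begin
      n * (2 * B)                                                ≡⟨ *-comm-middle n 2 B ⟩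
      2 * (n * B)                                                ≡⟨ cong (λ m → 2 * (m * B)) (length-allFin n) ⟨
      2 * (length (allFin n) * B)                                ≡⟨ cong (2 *_) (∑-const (allFin n) B) ⟨
      2 * ∑[ x ∈ allFin n ] B                                    ≤⟨ *-monoʳ-≤ 2 (∑-mono-≤ (allFin n) distances-from) ⟩
      2 * ∑[ x ∈ allFin n ] ∑[ y ∈ allFin n ] routeLength x y    ≤⟨ 2*∑∑routeLength≤∑∑edgeLoad ⟩
      ∑[ u ∈ allFin n ] ∑[ v ∈ allFin n ] edgeLoad u v           ≤⟨ ∑∑-edgeLoad≤ ⟩
      n * (4 * maxLoad R)                                        ≡⟨ cong (n *_) (*-assoc 2 2 (maxLoad R)) ⟩
      n * (2 * (2 * maxLoad R))                                  ∎))
      where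
      open ≤-Reasoning
      B : ℕ
      B = ballComplementSum n K
      *-comm-middle : ∀ a b c → a * (b * c) ≡ b * (a * c)
      *-comm-middle = solve-∀
      distances-from : ∀ x → B ≤ ∑[ y ∈ allFin n ] routeLength x y
      distances-from x = subst (λ m → ballComplementSum m K ≤ ∑[ y ∈ allFin n ] routeLength x y) (length-allFin n)
        (ballComplementSum≤∑ (allFin n) (routeLength x) (ball-bound x (routeLength x) (route-reach x)) K)

lemma2p2 : (n s : ℕ) → 5 ≤ n → 1 < s → 2 * s < n → (R : AllToAllRouting n s) →
    2 * n * ((n ∸ 1) * (2 * n + 147)) ^ 2 ≤ (12 * n * maxLoad R + (n ∸ 1) * (42 * n + 343)) ^ 2
lemma2p2 n@(suc _) s _ _ 2s<n R =
  forwardingBound n (maxLoad R) (Circulant.ballComplementSum≤2*maxLoad n s s≤n R)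
  where
  s≤n : s ≤ n
  s≤n = ≤-trans (m≤m+n s (s + 0)) (<⇒≤ 2s<n)
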